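{- Let $I$ be a projective set and let $(\phi_i)_{i\in I}$ be a family of predicates, $\phi_i$ a predicate on a set $A_i$. Define the predicate $\Phi$ on $\prod_{i\in I}A_i$ by $\Phi(f)\iff\exists i\in I.\,\phi_i(f(i))$, and the predicate $\Psi$ on $\prod_{i\in I}\mathcal{P}_{\mathrm{inh}}(A_i)$ by $\Psi(g)\iff\exists i\in I\,\exists x\in g(i).\,\phi_i(x)$. Then $\Phi$ and $\Psi$ are instance equivalent.
   Context: Work in intuitionistic higher-order logic (e.g. the internal language of an elementary topos), without excluded middle and without countable choice. A set $I$ is projective when every $I$-indexed family of inhabited sets has a choice function. $\mathcal{P}_{\mathrm{inh}}(X)$ is the set of inhabited subsets of $X$. A predicate $\phi$ on $A$ is instance reducible to a predicate $\psi$ on $B$, written $\phi\sqsubseteq\psi$, when $\forall x\in A\,\exists y\in B\,(\psi(y)\Rightarrow\phi(x))$; instance equivalent means reducible in both directions. -}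

module Defs where

open import Level using (Level; _⊔_) renaming (suc to lsuc)
open import Data.Product using (Σ; _×_; _,_)
open import Data.Irrelevant using (Irrelevant)

-- Propositional existence of HOL: the witness is propositionally truncated
-- (squashed via the proof-irrelevance modality).
∃ₚ : ∀ {a b} (A : Set a) → (A → Set b) → Set (a ⊔ b)
∃ₚ A P = Irrelevant (Σ A P)

Inhabited : ∀ {a} → Set a → Set a
Inhabited A = Irrelevant A

Pred : ∀ {a} ℓ → Set a → Set (a ⊔ lsuc ℓ)
Pred ℓ A = A → Set ℓ

Projective : ∀ {i} ℓ → Set i → Set (i ⊔ lsuc ℓ)
Projective ℓ I = (B : I → Set ℓ) → ((x : I) → Inhabited (B x)) → Inhabited ((x : I) → B x)

Pinh : ∀ {a} ℓ → Set a → Set (a ⊔ lsuc ℓ)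
Pinh ℓ A = Σ (Pred ℓ A) (λ S → ∃ₚ A S)

_∈ᵢ_ : ∀ {a ℓ} {A : Set a} → A → Pinh ℓ A → Set ℓ
x ∈ᵢ (S , _) = S x

_⊑_ : ∀ {a b p q} {A : Set a} {B : Set b} → Pred p A → Pred q B → Set (a ⊔ b ⊔ p ⊔ q)
_⊑_ {A = A} {B = B} φ ψ = (x : A) → ∃ₚ B (λ y → ψ y → φ x)

InstanceEquivalent : ∀ {a b p q} {A : Set a} {B : Set b} → Pred p A → Pred q B → Set (a ⊔ b ⊔ p ⊔ q)
InstanceEquivalent φ ψ = (φ ⊑ ψ) × (ψ ⊑ φ)

Φ : ∀ {i a p} {I : Set i} {A : I → Set a} → ((k : I) → Pred p (A k)) → Pred (i ⊔ p) ((k : I) → A k)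
Φ {I = I} φ f = ∃ₚ I (λ k → φ k (f k))

Ψ : ∀ {i a p ℓ} {I : Set i} {A : I → Set a} → ((k : I) → Pred p (A k)) → Pred (i ⊔ a ⊔ ℓ ⊔ p) ((k : I) → Pinh ℓ (A k))
Ψ {I = I} {A = A} φ g = ∃ₚ I (λ k → ∃ₚ (A k) (λ x → (x ∈ᵢ g k) × φ k x))

module Submission where

open import Level using (Level)
open import Data.Product using (Σ; _×_; _,_; proj₁; proj₂)
open import Data.Irrelevant using (Irrelevant; [_])
import Data.Irrelevant as Irrelevant
open import Relation.Nullary.Recomputable using (irrelevant-recompute)
open import Relation.Binary.PropositionalEquality using (_≡_; refl; subst)
open import Defs

-- Φ ⊑ Ψ needs no choice: send f to the family of singletons {f k}.
-- For Ψ ⊑ Φ, projectivity selects a point f k ∈ g k for every k; then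
-- φ k (f k) for some k exhibits a witness of Ψ φ g.

private
  variable
    ℓ : Level

join : {A : Set ℓ} → Irrelevant (Irrelevant A) → Irrelevant A
join x = x Irrelevant.>>= irrelevant-recompute

singleton : {A : Set ℓ} → A → Pinh ℓ A
singleton a = (λ x → x ≡ a) , [ (a , refl) ]

Ψ-singleton⇒Φ : {I : Set ℓ} {A : I → Set ℓ} (φ : (k : I) → Pred ℓ (A k))
                (f : (k : I) → A k) →
                Ψ {ℓ = ℓ} φ (λ k → singleton (f k)) → Φ φ f
Ψ-singleton⇒Φ φ f ψ = join (Irrelevant.map witness ψ)
  where
  witness : Σ _ (λ k → ∃ₚ _ (λ x → (x ∈ᵢ singleton (f k)) × φ k x)) → Φ φ f
  witness (k , ∃x) = Irrelevant.map (λ { (x , x≡fk , φx) → k , subst (φ k) x≡fk φx }) ∃x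

Φ⊑Ψ : {I : Set ℓ} {A : I → Set ℓ} (φ : (k : I) → Pred ℓ (A k)) →
      Φ {A = A} φ ⊑ Ψ {ℓ = ℓ} φ
Φ⊑Ψ φ f = [ (λ k → singleton (f k)) , Ψ-singleton⇒Φ φ f ]

Φ-selection⇒Ψ : {I : Set ℓ} {A : I → Set ℓ} (φ : (k : I) → Pred ℓ (A k))
                (g : (k : I) → Pinh ℓ (A k))
                (h : (k : I) → Σ (A k) (_∈ᵢ g k)) →
                Φ φ (λ k → proj₁ (h k)) → Ψ φ g
Φ-selection⇒Ψ φ g h = Irrelevant.map λ where
  (k , φhk) → k , [ proj₁ (h k) , proj₂ (h k) , φhk ]

Ψ⊑Φ : {I : Set ℓ} → Projective ℓ I → {A : I → Set ℓ}
      (φ : (k : I) → Pred ℓ (A k)) → Ψ {ℓ = ℓ} {A = A} φ ⊑ Φ φ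
Ψ⊑Φ projective {A} φ g =
  Irrelevant.map (λ h → (λ k → proj₁ (h k)) , Φ-selection⇒Ψ φ g h)
    (projective (λ k → Σ (A k) (_∈ᵢ g k)) (λ k → proj₂ (g k)))

mainTheorem8 : ∀ {ℓ : Level} (I : Set ℓ) → Projective ℓ I
    → (A : I → Set ℓ) (φ : (i : I) → Pred ℓ (A i))
    → InstanceEquivalent (Φ {A = A} φ) (Ψ {ℓ = ℓ} {A = A} φ)
mainTheorem8 I projective A φ = Φ⊑Ψ φ , Ψ⊑Φ projective φ
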